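{- Fix $0<\alpha<1$, let $n=|V(h,k)|$, let $m(x)=|V(T[x])|$, and let $h_0\ge 1$ with $h_0<h$ satisfy $m(h_0-1)>m(h)^{\alpha}$. Let $U\subseteq V(h,k)$ and let $\mathbf P\subseteq\mathbf P(U,h_0)$ be non-empty and independent. For each $P\in\mathbf P$, let $t_0(P)=bag(last(P))$, let $t_1(P)$ be an arbitrary child of $t_0(P)$, let $shift(P)$ be the path obtained from $P$ by appending the vertex $(t_1(P),index(last(P)))$ after $last(P)$ and removing $first(P)$, and let $U_1(P)=V(shift(P))\cup V(h,k,t_1(P))$. Let $U_0(\mathbf P)=\{first(P):P\in\mathbf P\}$ and $U_1(\mathbf P)=\bigcup_{P\in\mathbf P}U_1(P)$. Then $(U,U_0(\mathbf P),U_1(\mathbf P))$ is a target triple in $T[h,k]$.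
   Context: $T[h]$ complete rooted ternary tree of height $h$, $T[h,k]=T[h]\square P_k$ (Cartesian product with the path on $[k]$), $V(h,k)=V(T[h,k])$; for $v=(t,i)$, $bag(v)=t$, $index(v)=i$. Height = distance to a leaf; $V_a(h)$ nodes of height $a$; $V_{>a}(h,k)=\{(t,i):height(t)>a\}$, $V_a(h,k)=V_a(h)\times[k]$; $V(h,t)$ = descendants of $t$ (incl. $t$), $V(h,k,t)=V(h,t)\times[k]$; $\mathbf S_a(h,k)=\{V(h,t)\times[k]:t\in V_a(h)\}$. A $U,h_0$-path is a path $P$ of $T[h,k]$ with designated ends $first(P),last(P)$ such that: $V(P)\setminus\{last(P)\}\subseteq V_{>h_0}(h,k)$; $last(P)\in V_{h_0}(h,k)$, $anchor(P)$ being the member of $\mathbf S_{h_0}(h,k)$ containing $last(P)$; $(V(P)\cup anchor(P))\cap U=\emptyset$; $first(P)$ is adjacent to $U$ and no other vertex of $P$ is adjacent to $U$. $\mathbf P(U,h_0)$ is the set of such paths; $\mathbf P\subseteq\mathbf P(U,h_0)$ is independent if $first(\mathbf P)=\{first(P):P\in\mathbf P\}$ is independent, $N(first(\mathbf P))\cap U$ is independent, and each vertex of $N(first(\mathbf P))\cap U$ is adjacent to exactly one vertex of $first(\mathbf P)$. Target triple in a graph $G$ with $n=|V(G)|$: disjoint $W,U_0,U_1\subseteq V(G)$ with (1) every component of $G[U_1]$ has more than $n^\alpha$ vertices; (2) every vertex of $U_0$ is adjacent to $U_1$ and to $W$; (3) $U_1$ is not adjacent to $W$; (4) $U_0$ independent;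 (5) $N(U_0)\cap W$ independent; (6) $N(u_1)\cap W$ and $N(u_2)\cap W$ disjoint for distinct $u_1,u_2\in U_0$. -}

module Defs where

open import Level using (0ℓ)
open import Data.Nat using (ℕ; zero; suc; _+_; _*_; _∸_; _^_; _≤_; _<_)
open import Data.Integer using (∣_∣)
open import Data.Rational using (ℚ; ↥_; ↧ₙ_; 0ℚ; 1ℚ) renaming (_≤_ to _≤ℚ_; _<_ to _<ℚ_)
open import Data.Fin using (Fin; toℕ)
open import Data.List using (List; []; _∷_; _++_; [_]; length)
open import Data.List.NonEmpty using (List⁺; _∷_; toList; tail) renaming (head to head⁺; last to last⁺)
open import Data.List.Membership.Propositional using (_∈_)
open import Data.List.Relation.Unary.Unique.Propositional using (Unique)
open import Data.List.Relation.Unary.Linked using (Linked)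
open import Data.List.Relation.Unary.All using (All)
open import Data.Product using (Σ; ∃; ∃-syntax; _×_; _,_; proj₁; proj₂)
open import Data.Sum using (_⊎_)
open import Relation.Binary.PropositionalEquality using (_≡_; _≢_)
open import Relation.Nullary using (¬_)

-- The exponent α, 0 < α < 1, given (as a real number) by its strict
-- upper Dedekind cut  Above r  ⇔  α < r   (r rational).

record Exponent : Set₁ where
  field
    Above      : ℚ → Set
    up-closed  : ∀ {r s} → Above r → r ≤ℚ s → Above s
    rounded    : ∀ {r} → Above r → ∃[ s ] (s <ℚ r × Above s)
    below-one  : ∃[ r ] (r <ℚ 1ℚ × Above r)
    above-zero : ∃[ r ] (0ℚ <ℚ r × ¬ Above r)
open Exponent public

-- MorePow α n x  means  x > n ^ α   (for natural numbers n, x):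
-- there is a rational r = p/q with α < r and n ^ p < x ^ q.
MorePow : Exponent → ℕ → ℕ → Set
MorePow α n x = ∃[ r ] (Above α r × n ^ ∣ ↥ r ∣ < x ^ ↧ₙ r)

data Reach {V : Set} (Adj : V → V → Set) (S : V → Set) (u : V) : V → Set where
  here : S u → Reach Adj S u u
  step : ∀ {v w} → Reach Adj S u v → Adj v w → S w → Reach Adj S u w

record TargetTriple (α : Exponent) {V : Set} (Adj : V → V → Set) (n : ℕ)
                    (W U₀ U₁ : V → Set) : Set where
  field
    disjoint-WU₀  : ∀ v → W v → ¬ U₀ v
    disjoint-WU₁  : ∀ v → W v → ¬ U₁ v
    disjoint-U₀U₁ : ∀ v → U₀ v → ¬ U₁ v
    big-components : ∀ u → U₁ u →
      ∃[ xs ] (Unique xs × All (Reach Adj U₁ u) xs × MorePow α n (length xs))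
    U₀-adj-U₁ : ∀ u → U₀ u → ∃[ v ] (U₁ v × Adj u v)
    U₀-adj-W  : ∀ u → U₀ u → ∃[ w ] (W w × Adj u w)
    U₁-nonadj-W : ∀ u w → U₁ u → W w → ¬ Adj u w
    U₀-indep : ∀ u v → U₀ u → U₀ v → ¬ Adj u v
    NU₀W-indep : ∀ w w' → W w → W w' → (∃[ u ] (U₀ u × Adj u w)) →
      (∃[ u ] (U₀ u × Adj u w')) → ¬ Adj w w'
    private-nbhd : ∀ u₁ u₂ w → U₀ u₁ → U₀ u₂ → u₁ ≢ u₂ → W w →
      Adj u₁ w → ¬ Adj u₂ w

-- The complete rooted ternary tree T[h]: a node is its address from the
-- root, a list over {0,1,2} of length ≤ h.  Leaves have length h.

Node : ℕ → Set
Node h = Σ (List (Fin 3)) (λ a → length a ≤ h)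

addr : ∀ {h} → Node h → List (Fin 3)
addr = proj₁

height : ∀ {h} → Node h → ℕ
height {h} t = h ∸ length (addr t)

Child : ∀ {h} → Node h → Node h → Set
Child s t = ∃[ c ] (addr s ≡ addr t ++ [ c ])

TreeAdj : ∀ {h} → Node h → Node h → Set
TreeAdj s t = Child s t ⊎ Child t s

Desc : ∀ {h} → Node h → Node h → Set
Desc s t = ∃[ a ] (addr s ≡ addr t ++ a)

-- m(x) = |V(T[x])|
m : ℕ → ℕ
m zero    = 1
m (suc x) = 1 + 3 * m x

-- T[h,k] = T[h] □ P_k, with the path on [k] indexed by Fin k.

Vtx : ℕ → ℕ → Set
Vtx h k = Node h × Fin k

bag : ∀ {h k} → Vtx h k → Node h
bag = proj₁

index : ∀ {h k} → Vtx h k → Fin k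
index = proj₂

PathAdj : ∀ {k} → Fin k → Fin k → Set
PathAdj i j = toℕ j ≡ suc (toℕ i) ⊎ toℕ i ≡ suc (toℕ j)

Adj : ∀ {h k} → Vtx h k → Vtx h k → Set
Adj (t , i) (t' , i') = (t ≡ t' × PathAdj i i') ⊎ (i ≡ i' × TreeAdj t t')

nV : ℕ → ℕ → ℕ
nV h k = m h * k

record Path (h k : ℕ) : Set where
  constructor path
  field
    verts    : List⁺ (Vtx h k)
    distinct : Unique (toList verts)
    linked   : Linked Adj (toList verts)
open Path public

first : ∀ {h k} → Path h k → Vtx h k
first P = head⁺ (verts P)

last : ∀ {h k} → Path h k → Vtx h k
last P = last⁺ (verts P)

_∈P_ : ∀ {h k} → Vtx h k → Path h k → Set
v ∈P P = v ∈ toList (verts P)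

rest : ∀ {h k} → Path h k → List (Vtx h k)
rest P = tail (verts P)

IsUPath : ∀ {h k} → (Vtx h k → Set) → ℕ → Path h k → Set
IsUPath {h} {k} U h₀ P =
    (∀ v → v ∈P P → v ≢ last P → h₀ < height (bag v))
  × height (bag (last P)) ≡ h₀
  × (∀ v → v ∈P P → ¬ U v)
  × (∀ (v : Vtx h k) → Desc (bag v) (bag (last P)) → ¬ U v)   -- anchor(P) ∩ U = ∅
  × (∃[ u ] (U u × Adj (first P) u))
  × (∀ v → v ∈ rest P → ∀ u → U u → ¬ Adj v u)

-- 𝐏 (a finite set of paths, given as a list) is independent
Independent : ∀ {h k} → (Vtx h k → Set) → List (Path h k) → Set
Independent {h} {k} U Ps =
    (∀ P Q → P ∈ Ps → Q ∈ Ps → ¬ Adj (first P) (first Q))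
  × (∀ u u' → U u → U u' → (∃[ P ] (P ∈ Ps × Adj (first P) u))
       → (∃[ Q ] (Q ∈ Ps × Adj (first Q) u')) → ¬ Adj u u')
  × (∀ u → U u → ∀ P Q → P ∈ Ps → Q ∈ Ps →
       Adj (first P) u → Adj (first Q) u → first P ≡ first Q)

-- The construction.  `ch P : Fin 3` selects the child t₁(P) of t₀(P).

t₀ : ∀ {h k} → Path h k → List (Fin 3)
t₀ P = addr (bag (last P))

t₁ : ∀ {h k} → (Path h k → Fin 3) → Path h k → List (Fin 3)
t₁ ch P = t₀ P ++ [ ch P ]

InShift : ∀ {h k} → (Path h k → Fin 3) → Path h k → Vtx h k → Set
InShift ch P v = v ∈ rest P ⊎ (addr (bag v) ≡ t₁ ch P × index v ≡ index (last P))

InU₁P : ∀ {h k} → (Path h k → Fin 3) → Path h k → Vtx h k → Set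
InU₁P ch P v = InShift ch P v ⊎ (∃[ a ] (addr (bag v) ≡ t₁ ch P ++ a))

U₀ : ∀ {h k} → List (Path h k) → Vtx h k → Set
U₀ Ps v = ∃[ P ] (P ∈ Ps × v ≡ first P)

U₁ : ∀ {h k} → (Path h k → Fin 3) → List (Path h k) → Vtx h k → Set
U₁ ch Ps v = ∃[ P ] (P ∈ Ps × InU₁P ch P v)

-- Fix P ∈ 𝐏 and write t₁ for the chosen child of t₀ = bag(last P).  The block
-- V(h,k,t₁) is a copy of T[h₀ − 1] □ P_k, hence connected with m(h₀ − 1)·k > n^α
-- vertices, and every vertex of shift(P) walks along P and steps down from last(P)
-- into the block, so every component of G[U₁] is large.  The rest of shift(P)
-- avoids U and its neighbourhood because P does, and the block together with its
-- neighbours lies in anchor(P), which avoids U.  A first vertex lies on some path,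
-- so it has height ≥ h₀ and is not in a block (of height < h₀); it is adjacent to
-- U, so it is not in the rest of a path either.  The conditions (4)–(6) on U₀ are
-- exactly the independence of 𝐏.  For the size bound, m(h)^p < m(h₀ − 1)^q with
-- m(h₀ − 1) ≤ m(h) forces p ≤ q, so multiplying both bases by k preserves it.

module Submission where

open import Defs
open import Data.Nat
  using (ℕ; zero; suc; _+_; _*_; _∸_; _^_; _≤_; _<_; z≤n; s≤s; _≤?_; NonZero; >-nonZero⁻¹)
open import Data.Nat.Properties
open import Data.Integer using (∣_∣)
open import Data.Rational using (↥_; ↧ₙ_)
open import Data.Fin as Fin using (Fin; inject₁)
open import Data.Fin.Properties using (toℕ-inject₁; nonZeroIndex)
open import Data.Fin.Induction using (<-weakInduction)
open import Data.List
  using (List; []; _∷_; _++_; [_]; length; map; cartesianProductWith; allFin; initLast; _∷ʳ′_)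
open import Data.List.Properties
  using (length-++; length-map; length-tabulate; length-++-≤ˡ; ++-assoc; ++-identityʳ; ++-cancelˡ;
         ∷-injective; ∷ʳ-injectiveˡ)
open import Data.List.NonEmpty using (_∷_) renaming (last to last⁺)
open import Data.List.Membership.Propositional using (_∈_)
open import Data.List.Membership.Propositional.Properties using (∈-cartesianProductWith⁻)
open import Data.List.Relation.Unary.Any using (here; there)
open import Data.List.Relation.Unary.All as All using (All; _∷_)
open import Data.List.Relation.Unary.AllPairs as AllPairs using (_∷_)
open import Data.List.Relation.Unary.Linked using (Linked; _∷_)
open import Data.List.Relation.Unary.Unique.Propositional using (Unique)
open import Data.List.Relation.Unary.Unique.Propositional.Properties using (cartesianProductWith⁺; allFin⁺)
open import Data.Product using (∃-syntax; _×_; _,_; proj₁; proj₂)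
open import Data.Sum using (_⊎_; inj₁; inj₂; [_,_]′)
open import Data.Empty using (⊥; ⊥-elim)
open import Relation.Binary.Definitions using (Symmetric)
open import Relation.Binary.PropositionalEquality hiding ([_])
open import Relation.Nullary using (¬_; yes; no)

last⁺-∷ : ∀ {A : Set} (x y : A) ys → last⁺ (x ∷ y ∷ ys) ≡ last⁺ (y ∷ ys)
last⁺-∷ x y ys with initLast ys
... | []      = refl
... | _ ∷ʳ′ _ = refl

module _ {V : Set} {A : V → V → Set} {S : V → Set} where

  Reach-target : ∀ {u v} → Reach A S u v → S v
  Reach-target (here s)     = s
  Reach-target (step _ _ s) = s

  Reach-edge : ∀ {u v} → S u → A u v → S v → Reach A S u v
  Reach-edge su a sv = step (here su) a sv

  Reach-trans : ∀ {u v w} → Reach A S u v → Reach A S v w → Reach A S u w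
  Reach-trans r (here _)      = r
  Reach-trans r (step r′ a s) = step (Reach-trans r r′) a s

  Reach-sym : Symmetric A → ∀ {u v} → Reach A S u v → Reach A S v u
  Reach-sym sym-A (here s)     = here s
  Reach-sym sym-A (step r a s) =
    Reach-trans (Reach-edge s (sym-A a) (Reach-target r)) (Reach-sym sym-A r)

  Reach-along : ∀ {v} x xs → Linked A (x ∷ xs) → All S (x ∷ xs) →
                v ∈ x ∷ xs → Reach A S v (last⁺ (x ∷ xs))
  Reach-along x []       _       (sx ∷ _) (here refl) = here sx
  Reach-along x []       _       _        (there ())
  Reach-along x (y ∷ ys) (a ∷ l) (sx ∷ s) v∈ rewrite last⁺-∷ x y ys with v∈
  ... | here refl = Reach-trans (Reach-edge sx a (All.head s)) (Reach-along y ys l s (here refl))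
  ... | there v∈′ = Reach-along y ys l s v∈′

^-distribʳ-* : ∀ a b p → (a * b) ^ p ≡ a ^ p * b ^ p
^-distribʳ-* a b zero    = refl
^-distribʳ-* a b (suc p) = begin
  a * b * (a * b) ^ p      ≡⟨ cong (a * b *_) (^-distribʳ-* a b p) ⟩
  a * b * (a ^ p * b ^ p)  ≡⟨ [m*n]*[o*p]≡[m*o]*[n*p] a b (a ^ p) (b ^ p) ⟩
  a * a ^ p * (b * b ^ p)  ∎
  where open ≡-Reasoning

exponents-≤ : ∀ {A B p q} .{{_ : NonZero B}} → B ≤ A → A ^ p < B ^ q → p ≤ q
exponents-≤ {A} {B} {p} {q} B≤A lt with p ≤? q
... | yes p≤q = p≤q
... | no  p≰q = ⊥-elim (<⇒≱ lt (≤-trans (^-monoʳ-≤ B (<⇒≤ (≰⇒> p≰q))) (^-monoˡ-≤ p B≤A)))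

MorePow-*ʳ : ∀ {α A B} K .{{_ : NonZero B}} .{{_ : NonZero K}} →
             B ≤ A → MorePow α A B → MorePow α (A * K) (B * K)
MorePow-*ʳ {A = A} {B} K B≤A (r , α<r , lt) = r , α<r , (begin-strict
  (A * K) ^ p    ≡⟨ ^-distribʳ-* A K p ⟩
  A ^ p * K ^ p  <⟨ *-monoˡ-< (K ^ p) {{m^n≢0 K p}} lt ⟩
  B ^ q * K ^ p  ≤⟨ *-monoʳ-≤ (B ^ q) (^-monoʳ-≤ K (exponents-≤ {A} {B} {p} {q} B≤A lt)) ⟩
  B ^ q * K ^ q  ≡⟨ ^-distribʳ-* B K q ⟨
  (B * K) ^ q    ∎)
  where
  open ≤-Reasoning
  p = ∣ ↥ r ∣
  q = ↧ₙ r

m-nonZero : ∀ x → NonZero (m x)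
m-nonZero zero    = _
m-nonZero (suc _) = _

m-mono : ∀ {x y} → x ≤ y → m x ≤ m y
m-mono {y = y} z≤n   = >-nonZero⁻¹ (m y) {{m-nonZero y}}
m-mono (s≤s x≤y)     = s≤s (*-monoʳ-≤ 3 (m-mono x≤y))

length-cartesianProductWith : ∀ {A B C : Set} (f : A → B → C) xs ys →
  length (cartesianProductWith f xs ys) ≡ length xs * length ys
length-cartesianProductWith f []       ys = refl
length-cartesianProductWith f (x ∷ xs) ys = begin
  length (map (f x) ys ++ cartesianProductWith f xs ys)          ≡⟨ length-++ (map (f x) ys) ⟩
  length (map (f x) ys) + length (cartesianProductWith f xs ys)  ≡⟨ cong₂ _+_ (length-map (f x) ys)
                                                                      (length-cartesianProductWith f xs ys) ⟩
  length ys + length xs * length ys                              ∎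
  where open ≡-Reasoning

module _ {h : ℕ} where

  Node-≡ : {s t : Node h} → addr s ≡ addr t → s ≡ t
  Node-≡ {a , p} {.a , q} refl = cong (a ,_) (≤-irrelevant p q)

  Desc-refl : (t : Node h) → Desc t t
  Desc-refl t = [] , sym (++-identityʳ (addr t))

  Desc-trans : (s t u : Node h) → Desc s t → Desc t u → Desc s u
  Desc-trans _ _ _ (b , s≡t++b) (a , t≡u++a) =
    a ++ b , trans s≡t++b (trans (cong (_++ b) t≡u++a) (++-assoc _ a b))

  height-++ : {s t : Node h} (b : List (Fin 3)) → addr s ≡ addr t ++ b → height s ≡ height t ∸ length b
  height-++ {s} {t} b e = begin
    h ∸ length (addr s)                ≡⟨ cong (λ a → h ∸ length a) e ⟩
    h ∸ length (addr t ++ b)           ≡⟨ cong (h ∸_) (length-++ (addr t)) ⟩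
    h ∸ (length (addr t) + length b)   ≡⟨ ∸-+-assoc h (length (addr t)) (length b) ⟨
    h ∸ length (addr t) ∸ length b     ∎
    where open ≡-Reasoning

  Desc-height-≤ : (s t : Node h) → Desc s t → height s ≤ height t
  Desc-height-≤ s t (b , e) = ≤-trans (≤-reflexive (height-++ {s} {t} b e)) (m∸n≤m _ (length b))

  graft : (t : Node h) → Node (height t) → Node h
  graft t s = addr t ++ addr s , (begin
    length (addr t ++ addr s)         ≡⟨ length-++ (addr t) ⟩
    length (addr t) + length (addr s) ≤⟨ +-monoʳ-≤ (length (addr t)) (proj₂ s) ⟩
    length (addr t) + height t        ≡⟨ m+[n∸m]≡n (proj₂ t) ⟩
    h                                 ∎)
    where open ≤-Reasoning

  child : (t : Node h) → 0 < height t → Fin 3 → Node h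
  child t 0<ht c = graft t ([ c ] , 0<ht)

  child-Desc : ∀ t p c → Desc (child t p c) t
  child-Desc _ _ c = [ c ] , refl

  Desc-parent : ∀ {s u t : Node h} {c c′} b →
                addr s ≡ addr u ++ [ c′ ] → addr s ≡ addr t ++ (c ∷ b) → Desc u t
  Desc-parent {s} {u} {t} b e₁ e₂ with initLast b
  ... | []       = [] , trans (∷ʳ-injectiveˡ (addr u) (addr t) (trans (sym e₁) e₂)) (sym (++-identityʳ _))
  Desc-parent {s} {u} {t} {c} .(bs ++ [ z ]) e₁ e₂ | bs ∷ʳ′ z =
    c ∷ bs , ∷ʳ-injectiveˡ (addr u) (addr t ++ c ∷ bs)
               (trans (sym e₁) (trans e₂ (sym (++-assoc (addr t) (c ∷ bs) [ z ]))))

root : ∀ {d} → Node d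
root = [] , z≤n

prepend : ∀ {d} → Fin 3 → Node d → Node (suc d)
prepend c (a , p) = c ∷ a , s≤s p

prepend-injective : ∀ {d c c′} {s s′ : Node d} → prepend c s ≡ prepend c′ s′ → c ≡ c′ × s ≡ s′
prepend-injective {s = _ , _} {_ , _} e with ∷-injective (cong addr e)
... | c≡c′ , a≡a′ = c≡c′ , Node-≡ a≡a′

root≢prepend : ∀ {d c} {s : Node d} → root ≢ prepend c s
root≢prepend {s = _ , _} ()

nodes : (d : ℕ) → List (Node d)
nodes zero    = root ∷ []
nodes (suc d) = root ∷ cartesianProductWith prepend (allFin 3) (nodes d)

nodes-length : ∀ d → length (nodes d) ≡ m d
nodes-length zero    = refl
nodes-length (suc d) =
  cong suc (trans (length-cartesianProductWith prepend (allFin 3) (nodes d)) (cong (3 *_) (nodes-length d)))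

nodes-unique : ∀ d → Unique (nodes d)
nodes-unique zero    = All.[] ∷ AllPairs.[]
nodes-unique (suc d) =
  All.tabulate root-fresh ∷ cartesianProductWith⁺ prepend prepend-injective (allFin⁺ 3) (nodes-unique d)
  where
  root-fresh : ∀ {v} → v ∈ cartesianProductWith prepend (allFin 3) (nodes d) → root ≢ v
  root-fresh v∈ with ∈-cartesianProductWith⁻ prepend (allFin 3) (nodes d) v∈
  ... | _ , _ , _ , _ , refl = root≢prepend

Adj-sym : ∀ {h k} → Symmetric (Adj {h} {k})
Adj-sym (inj₁ (e , inj₁ p)) = inj₁ (sym e , inj₂ p)
Adj-sym (inj₁ (e , inj₂ p)) = inj₁ (sym e , inj₁ p)
Adj-sym (inj₂ (e , inj₁ p)) = inj₂ (sym e , inj₂ p)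
Adj-sym (inj₂ (e , inj₂ p)) = inj₂ (sym e , inj₁ p)

subtree-vertices : ∀ {h} k (t : Node h) →
  ∃[ xs ] (Unique xs × All (λ (v : Vtx h k) → Desc (bag v) t) xs × length xs ≡ m (height t) * k)
subtree-vertices k t =
    cartesianProductWith vertex (nodes (height t)) (allFin k)
  , cartesianProductWith⁺ vertex vertex-injective (nodes-unique (height t)) (allFin⁺ k)
  , All.tabulate below
  , trans (length-cartesianProductWith vertex (nodes (height t)) (allFin k))
          (cong₂ _*_ (nodes-length (height t)) (length-tabulate (λ i → i)))
  where
  vertex : Node (height t) → Fin k → Vtx _ k
  vertex s i = graft t s , i
  vertex-injective : ∀ {s s′ i i′} → vertex s i ≡ vertex s′ i′ → s ≡ s′ × i ≡ i′
  vertex-injective e = Node-≡ (++-cancelˡ (addr t) _ _ (cong (λ v → addr (bag v)) e)) , cong index e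
  below : ∀ {v} → v ∈ cartesianProductWith vertex (nodes (height t)) (allFin k) → Desc (bag v) t
  below v∈ with ∈-cartesianProductWith⁻ vertex (nodes (height t)) (allFin k) v∈
  ... | s , _ , _ , _ , refl = addr s , refl

child-subtree-boundary : ∀ {h k} (t : Node h) p c {v w : Vtx h k} →
  Desc (bag v) (child t p c) → Adj v w → Desc (bag w) t
child-subtree-boundary t p c {v} d (inj₁ (bag≡ , _)) =
  subst (λ s → Desc s t) bag≡ (Desc-trans (bag v) (child t p c) t d (child-Desc t p c))
child-subtree-boundary t p c {v} {w} (b , e) (inj₂ (_ , inj₁ (_ , e′))) =
  Desc-parent {s = bag v} {bag w} {t} b e′ (trans e (++-assoc (addr t) [ c ] b))
child-subtree-boundary t p c {v} {w} d (inj₂ (_ , inj₂ (c′ , e′))) =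
  Desc-trans (bag w) (child t p c) t
    (Desc-trans (bag w) (bag v) (child t p c) ([ c′ ] , e′) d) (child-Desc t p c)

index-walk : ∀ {h k} {S : Vtx h k → Set} (t : Node h) → (∀ i → S (t , i)) →
             ∀ i j → Reach Adj S (t , i) (t , j)
index-walk {k = suc _} {S} t S-t i j = Reach-trans (Reach-sym Adj-sym (from-zero i)) (from-zero j)
  where
  from-zero : ∀ j → Reach Adj S (t , Fin.zero) (t , j)
  from-zero = <-weakInduction (λ j → Reach Adj S (t , Fin.zero) (t , j)) (here (S-t _))
    (λ j r → step r (inj₁ (refl , inj₁ (cong suc (sym (toℕ-inject₁ j))))) (S-t _))

module Subtree {h k} {S : Vtx h k → Set} (t : Node h) (S-subtree : ∀ v → Desc (bag v) t → S v) where

  descend : ∀ a {x w : Node h} {i} → Desc x t → addr w ≡ addr x ++ a → Reach Adj S (x , i) (w , i)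
  descend [] {x} {w} {i} dx e =
    subst (λ s → Reach Adj S (x , i) (s , i)) (Node-≡ (sym (trans e (++-identityʳ _)))) (here (S-subtree _ dx))
  descend (c ∷ a) {x} {w} {i} dx e =
    Reach-trans (Reach-edge (S-subtree (x , i) dx) (inj₂ (refl , inj₂ (c , refl))) (S-subtree (y , i) dy))
                (descend a dy e′)
    where
    e′ : addr w ≡ (addr x ++ [ c ]) ++ a
    e′ = trans e (sym (++-assoc (addr x) [ c ] a))
    y : Node h
    y = addr x ++ [ c ] ,
        ≤-trans (length-++-≤ˡ (addr x ++ [ c ])) (≤-trans (≤-reflexive (cong length (sym e′))) (proj₂ w))
    dy : Desc y t
    dy = Desc-trans y x t ([ c ] , refl) dx

  connected : ∀ i {v} → Desc (bag v) t → Reach Adj S (t , i) v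
  connected i {_ , j} (a , e) =
    Reach-trans (index-walk t (λ j → S-subtree (t , j) (Desc-refl t)) i j) (descend a (Desc-refl t) e)

module _ {h k : ℕ} where

  first∈P : (P : Path h k) → first P ∈P P
  first∈P (path (_ ∷ _) _ _) = here refl

  rest⊆P : (P : Path h k) → ∀ {v} → v ∈ rest P → v ∈P P
  rest⊆P (path (_ ∷ _) _ _) = there

  first-step : (P : Path h k) → (∃[ y ] (y ∈ rest P × Adj (first P) y)) ⊎ first P ≡ last P
  first-step (path (_ ∷ [])    _ _)       = inj₂ refl
  first-step (path (_ ∷ y ∷ _) _ (a ∷ _)) = inj₁ (y , here refl , a)

  rest-reaches-last : ∀ {S : Vtx h k → Set} (P : Path h k) → (∀ {v} → v ∈ rest P → S v) →
                      ∀ {v} → v ∈ rest P → Reach Adj S v (last P)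
  rest-reaches-last {S} (path (x ∷ y ∷ ys) _ (_ ∷ l)) S-rest v∈ =
    subst (Reach Adj S _) (sym (last⁺-∷ x y ys)) (Reach-along y ys l (All.tabulate S-rest) v∈)

module UPath {h k} (U : Vtx h k → Set) {h₀} (1≤h₀ : 1 ≤ h₀) (ch : Path h k → Fin 3)
             (P : Path h k) (isU : IsUPath U h₀ P) where

  interior-high : ∀ v → v ∈P P → v ≢ last P → h₀ < height (bag v)
  interior-high = proj₁ isU

  last-height : height (bag (last P)) ≡ h₀
  last-height = proj₁ (proj₂ isU)

  avoids-U : ∀ v → v ∈P P → ¬ U v
  avoids-U = proj₁ (proj₂ (proj₂ isU))

  anchor-avoids-U : ∀ (v : Vtx h k) → Desc (bag v) (bag (last P)) → ¬ U v
  anchor-avoids-U = proj₁ (proj₂ (proj₂ (proj₂ isU)))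

  first-touches-U : ∃[ u ] (U u × Adj (first P) u)
  first-touches-U = proj₁ (proj₂ (proj₂ (proj₂ (proj₂ isU))))

  rest-far-from-U : ∀ v → v ∈ rest P → ∀ u → U u → ¬ Adj v u
  rest-far-from-U = proj₂ (proj₂ (proj₂ (proj₂ (proj₂ isU))))

  path-height : ∀ v → v ∈P P → h₀ ≤ height (bag v)
  path-height v v∈ with h₀ ≤? height (bag v)
  ... | yes h₀≤ = h₀≤
  ... | no  h₀≰ =
    ⊥-elim (h₀≰ (<⇒≤ (interior-high v v∈ λ { refl → h₀≰ (≤-reflexive (sym last-height)) })))

  last-nonleaf : 0 < height (bag (last P))
  last-nonleaf = subst (0 <_) (sym last-height) 1≤h₀

  tip : Node h
  tip = child (bag (last P)) last-nonleaf (ch P)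

  tip-vertex : Vtx h k
  tip-vertex = tip , index (last P)

  last-adj-tip : Adj (last P) tip-vertex
  last-adj-tip = inj₂ (refl , inj₂ (ch P , refl))

  tip-height : height tip ≡ h₀ ∸ 1
  tip-height = trans (height-++ {s = tip} {t = bag (last P)} [ ch P ] refl) (cong (_∸ 1) last-height)

  subtree-low : ∀ (v : Vtx h k) → Desc (bag v) tip → height (bag v) < h₀
  subtree-low v d =
    ≤-<-trans (≤-trans (Desc-height-≤ (bag v) tip d) (≤-reflexive tip-height)) (∸-monoʳ-< (s≤s z≤n) 1≤h₀)

  U₁P-cases : ∀ v → InU₁P ch P v → v ∈ rest P ⊎ Desc (bag v) tip
  U₁P-cases v (inj₁ (inj₁ v∈))     = inj₁ v∈
  U₁P-cases v (inj₁ (inj₂ (e , _))) = inj₂ ([] , trans e (sym (++-identityʳ _)))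
  U₁P-cases v (inj₂ d)              = inj₂ d

  U₁P-avoids-U : ∀ v → InU₁P ch P v → ¬ U v
  U₁P-avoids-U v inU with U₁P-cases v inU
  ... | inj₁ v∈ = avoids-U v (rest⊆P P v∈)
  ... | inj₂ d  =
    anchor-avoids-U v (Desc-trans (bag v) tip (bag (last P)) d (child-Desc (bag (last P)) last-nonleaf (ch P)))

  U₁P-far-from-U : ∀ v w → InU₁P ch P v → U w → ¬ Adj v w
  U₁P-far-from-U v w inU Uw adj with U₁P-cases v inU
  ... | inj₁ v∈ = rest-far-from-U v v∈ w Uw adj
  ... | inj₂ d  = anchor-avoids-U w (child-subtree-boundary (bag (last P)) last-nonleaf (ch P) d adj) Uw

module Shifted {h k} (U : Vtx h k → Set) {h₀} (1≤h₀ : 1 ≤ h₀) {Ps : List (Path h k)}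
               (valid : ∀ P → P ∈ Ps → IsUPath U h₀ P) (ch : Path h k → Fin 3) where

  module _ {P} (P∈ : P ∈ Ps) where
    open UPath U 1≤h₀ ch P (valid P P∈)

    subtree⊆U₁ : ∀ v → Desc (bag v) tip → U₁ ch Ps v
    subtree⊆U₁ v d = P , P∈ , inj₂ d

    open Subtree tip subtree⊆U₁

    reaches-tip : ∀ u → InU₁P ch P u → Reach Adj (U₁ ch Ps) u tip-vertex
    reaches-tip u inU with U₁P-cases u inU
    ... | inj₁ u∈ = step (rest-reaches-last P (λ v∈ → P , P∈ , inj₁ (inj₁ v∈)) u∈) last-adj-tip
                         (subtree⊆U₁ tip-vertex (Desc-refl tip))
    ... | inj₂ d  = Reach-sym Adj-sym (connected (index (last P)) d)

    U₁P-component : ∀ u → InU₁P ch P u →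
      ∃[ xs ] (Unique xs × All (Reach Adj (U₁ ch Ps) u) xs × length xs ≡ m (h₀ ∸ 1) * k)
    U₁P-component u inU with subtree-vertices k tip
    ... | xs , unique , below , len =
      xs , unique , All.map (λ d → Reach-trans (reaches-tip u inU) (connected _ d)) below ,
      trans len (cong (λ x → m x * k) tip-height)

  U₁-component : ∀ u → U₁ ch Ps u →
    ∃[ xs ] (Unique xs × All (Reach Adj (U₁ ch Ps) u) xs × length xs ≡ m (h₀ ∸ 1) * k)
  U₁-component u (_ , P∈ , inU) = U₁P-component P∈ u inU

  U₀-avoids-U : ∀ v → U v → ¬ U₀ Ps v
  U₀-avoids-U v Uv (P , P∈ , refl) = avoids-U (first P) (first∈P P) Uv
    where open UPath U 1≤h₀ ch P (valid P P∈)

  U₁-avoids-U : ∀ v → U v → ¬ U₁ ch Ps v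
  U₁-avoids-U v Uv (P , P∈ , inU) = U₁P-avoids-U v inU Uv
    where open UPath U 1≤h₀ ch P (valid P P∈)

  U₀-avoids-U₁ : ∀ v → U₀ Ps v → ¬ U₁ ch Ps v
  U₀-avoids-U₁ v (P , P∈ , refl) (Q , Q∈ , inU) =
    [ in-rest , in-subtree ]′ (Q.U₁P-cases (first P) inU)
    where
    module P = UPath U 1≤h₀ ch P (valid P P∈)
    module Q = UPath U 1≤h₀ ch Q (valid Q Q∈)
    in-rest : first P ∈ rest Q → ⊥
    in-rest v∈ = let u , Uu , adj = P.first-touches-U in Q.rest-far-from-U (first P) v∈ u Uu adj
    in-subtree : Desc (bag (first P)) Q.tip → ⊥
    in-subtree d = <⇒≱ (Q.subtree-low (first P) d) (P.path-height (first P) (first∈P P))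

  U₀-adj-U : ∀ u → U₀ Ps u → ∃[ w ] (U w × Adj u w)
  U₀-adj-U u (P , P∈ , refl) = first-touches-U
    where open UPath U 1≤h₀ ch P (valid P P∈)

  U₀-adj-U₁ : ∀ u → U₀ Ps u → ∃[ v ] (U₁ ch Ps v × Adj u v)
  U₀-adj-U₁ u (P , P∈ , refl) with first-step P
  ... | inj₁ (y , y∈ , adj)  = y , (P , P∈ , inj₁ (inj₁ y∈)) , adj
  ... | inj₂ first≡last     =
    tip-vertex , subtree⊆U₁ P∈ tip-vertex (Desc-refl tip) ,
    subst (λ x → Adj x tip-vertex) (sym first≡last) last-adj-tip
    where open UPath U 1≤h₀ ch P (valid P P∈)

  U₁-far-from-U : ∀ u w → U₁ ch Ps u → U w → ¬ Adj u w
  U₁-far-from-U u w (P , P∈ , inU) = U₁P-far-from-U u w inU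
    where open UPath U 1≤h₀ ch P (valid P P∈)

lemma16 : (α : Exponent) (h k h₀ : ℕ) → 1 ≤ h₀ → h₀ < h →
    MorePow α (m h) (m (h₀ ∸ 1)) →
    (U : Vtx h k → Set) (Ps : List (Path h k)) → Ps ≢ [] →
    (∀ P → P ∈ Ps → IsUPath U h₀ P) → Independent U Ps →
    (ch : Path h k → Fin 3) →
    TargetTriple α (Adj {h} {k}) (nV h k) U (U₀ Ps) (U₁ ch Ps)
lemma16 α h k h₀ 1≤h₀ h₀<h mp U Ps _ valid (first-indep , nbhd-indep , nbhd-private) ch = record
  { disjoint-WU₀   = U₀-avoids-U
  ; disjoint-WU₁   = U₁-avoids-U
  ; disjoint-U₀U₁  = U₀-avoids-U₁
  ; big-components = λ u u∈ → let xs , unique , reach , len = U₁-component u u∈ in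
                       xs , unique , reach , subst (MorePow α (nV h k)) (sym len) (large u)
  ; U₀-adj-U₁      = U₀-adj-U₁
  ; U₀-adj-W       = U₀-adj-U
  ; U₁-nonadj-W    = U₁-far-from-U
  ; U₀-indep       = λ { _ _ (P , P∈ , refl) (Q , Q∈ , refl) → first-indep P Q P∈ Q∈ }
  ; NU₀W-indep     = λ { w w′ Uw Uw′ (_ , (P , P∈ , refl) , adj) (_ , (Q , Q∈ , refl) , adj′) →
                         nbhd-indep w w′ Uw Uw′ (P , P∈ , adj) (Q , Q∈ , adj′) }
  ; private-nbhd   = λ { _ _ w (P , P∈ , refl) (Q , Q∈ , refl) P≢Q Uw adj adj′ →
                         P≢Q (nbhd-private w Uw P Q P∈ Q∈ adj adj′) }
  }
  where
  open Shifted U 1≤h₀ valid ch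
  large : Vtx h k → MorePow α (nV h k) (m (h₀ ∸ 1) * k)
  large u = MorePow-*ʳ {α} {m h} {m (h₀ ∸ 1)} k {{m-nonZero (h₀ ∸ 1)}} {{nonZeroIndex (index u)}}
              (m-mono (≤-trans (m∸n≤m h₀ 1) (<⇒≤ h₀<h))) mp
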